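{- For the directed path $P_n=(v_1,v_2,\dots,v_n)$ (arcs $v_iv_{i+1}$, $1\le i<n$), $n\ge 1$, we have $\gamma_{oso}(P_n)=\lceil 2n/3\rceil$.
   Context: For a digraph $D=(V,A)$ and $v\in V$, $N^-(v)=\{w: wv\in A\}$. A set $S\subseteq V$ is out-dominating if every $v\in V\setminus S$ has an in-neighbor in $S$. $S$ is an out-secure out-dominating set (OSODS) if $S$ is out-dominating and for every $v\in V\setminus S$ there is $u\in N^-(v)\cap S$ such that $(S\setminus\{u\})\cup\{v\}$ is out-dominating. $\gamma_{oso}(D)$ is the minimum size of an OSODS of $D$. -}

module Defs where

open import Data.Nat using (ℕ; suc)
open import Data.Fin using (Fin; toℕ)
open import Data.Fin.Subset using (Subset; _∈_; _∉_; _-_; _∪_; ⁅_⁆; ∣_∣)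
open import Data.Product using (Σ; ∃; _×_; _,_)
open import Relation.Binary.PropositionalEquality using (_≡_)
open import Level using (0ℓ)
open import Relation.Binary using (Rel)

record Digraph : Set₁ where
  field
    n   : ℕ
    Arc : Rel (Fin n) 0ℓ
open Digraph public

OutDominating : (D : Digraph) → Subset (n D) → Set
OutDominating D S = ∀ v → v ∉ S → ∃ λ u → u ∈ S × Arc D u v

IsOSODS : (D : Digraph) → Subset (n D) → Set
IsOSODS D S =
  OutDominating D S ×
  (∀ v → v ∉ S → ∃ λ u → u ∈ S × Arc D u v × OutDominating D ((S - u) ∪ ⁅ v ⁆))

IsMinOSODSSize : (D : Digraph) → ℕ → Set
IsMinOSODSSize D k =
  (∃ λ S → IsOSODS D S × ∣ S ∣ ≡ k) × (∀ S → IsOSODS D S → k Data.Nat.≤ ∣ S ∣)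

-- The directed path P_m on vertices v_1..v_m (here indices 0..m-1):
-- arcs v_i v_{i+1}.
PathArc : (m : ℕ) → Rel (Fin m) 0ℓ
PathArc m u v = suc (toℕ u) ≡ toℕ v

P : ℕ → Digraph
P m = record { n = m ; Arc = PathArc m }

module Submission where

-- A set S is an OSODS of the path 0 → 1 → ⋯ → m-1 iff 0, 1 ∈ S and every vertex
-- i + 2 ∉ S has both i, i + 1 ∈ S: the defender u = i + 1 of v = i + 2 leaves S in
-- the swap, and only i can then dominate u.  Hence any window of three consecutive
-- vertices contains at most one vertex outside S, so 3 ∣S∣ ≥ 2m; omitting every
-- third vertex attains ⌈2m/3⌉.

open import Defs
open import Data.Nat using (ℕ; zero; suc; _≤_; _<_; _+_; _*_; _/_; z≤n; s≤s; s≤s⁻¹)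
open import Data.Nat.Properties using (≤-trans; ≤-reflexive; <-trans; n≤1+n; +-monoʳ-≤; 1+n≢n; m≢1+n+m; module ≤-Reasoning)
open import Data.Nat.DivMod using (+-distrib-/-∣ˡ; m<n*o⇒m/o<n)
open import Data.Nat.Divisibility using (divides-refl)
open import Data.Nat.Tactic.RingSolver using (solve-∀)
open import Data.Bool.Properties using (¬-not)
open import Data.Vec using (_∷_; []; lookup; here; there)
open import Data.Vec.Properties using ([]=⇒lookup; lookup⇒[]=)
open import Data.Fin using (Fin; toℕ; fromℕ<; _≟_)
open import Data.Fin.Properties using (toℕ-fromℕ<; toℕ-injective; toℕ<n)
open import Data.Fin.Subset using (Subset; Side; inside; outside; _∈_; _∉_; _-_; _∪_; ⁅_⁆; ∣_∣)
open import Data.Fin.Subset.Properties using (x∈p∪q⁻; x∈p∪q⁺; x∈⁅x⁆; x∈⁅y⁆⇒x≡y; p─q⊆p; x∈p∧x≢y⇒x∈p-y)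
open import Data.Product using (∃; ∃₂; _×_; _,_)
open import Data.Sum using (_⊎_; inj₁; inj₂)
open import Data.Empty using (⊥-elim)
open import Function using (_∘_)
open import Relation.Nullary using (¬_; yes; no)
open import Relation.Binary.PropositionalEquality using (_≡_; _≢_; refl; sym; trans; cong; subst; module ≡-Reasoning)

private
  variable
    k m : ℕ
    S : Subset k

-- Indices past the end read as inside, so an outside index is a genuine vertex.
_‼_ : Subset k → ℕ → Side
[]      ‼ _     = inside
(s ∷ _) ‼ zero  = s
(_ ∷ S) ‼ suc i = S ‼ i

DoublyDominated : Subset k → Set
DoublyDominated S =
  ∀ i → S ‼ i ≡ outside → ∃ λ j → i ≡ 2 + j × S ‼ j ≡ inside × S ‼ (1 + j) ≡ inside

‼-toℕ : ∀ (S : Subset k) x → S ‼ toℕ x ≡ lookup S x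
‼-toℕ (_ ∷ _) Fin.zero    = refl
‼-toℕ (_ ∷ S) (Fin.suc x) = ‼-toℕ S x

∈⇒‼≡inside : ∀ {x} → x ∈ S → S ‼ toℕ x ≡ inside
∈⇒‼≡inside {S = S} {x} x∈S = trans (‼-toℕ S x) ([]=⇒lookup x∈S)

‼≡inside⇒∈ : ∀ {x i} → toℕ x ≡ i → S ‼ i ≡ inside → x ∈ S
‼≡inside⇒∈ {S = S} {x} refl Sₓ = lookup⇒[]= x S (trans (sym (‼-toℕ S x)) Sₓ)

∉⇒‼≡outside : ∀ {x} → x ∉ S → S ‼ toℕ x ≡ outside
∉⇒‼≡outside x∉S = ¬-not (x∉S ∘ ‼≡inside⇒∈ refl)

‼≡outside⇒< : ∀ (S : Subset k) i → S ‼ i ≡ outside → i < k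
‼≡outside⇒< (_ ∷ _) zero    _  = s≤s z≤n
‼≡outside⇒< (_ ∷ S) (suc i) Sᵢ = s≤s (‼≡outside⇒< S i Sᵢ)

‼≡outside⇒∉ : ∀ {i} → S ‼ i ≡ outside → ∃ λ x → toℕ x ≡ i × x ∉ S
‼≡outside⇒∉ {S = S} {i} Sᵢ = x , toℕx≡i , x∉S
  where
  i<k = ‼≡outside⇒< S i Sᵢ
  x = fromℕ< i<k
  toℕx≡i = toℕ-fromℕ< i<k
  x∉S : x ∉ S
  x∉S x∈S with () ← trans (sym Sᵢ) (subst (λ n → S ‼ n ≡ inside) toℕx≡i (∈⇒‼≡inside x∈S))

below : ∀ {j} (x : Fin k) → j < toℕ x → ∃ λ y → toℕ y ≡ j
below x j<x = fromℕ< j<k , toℕ-fromℕ< j<k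
  where j<k = <-trans j<x (toℕ<n x)

module _ {m : ℕ} where

  pathArc-irrefl : ∀ {u} → ¬ PathArc m u u
  pathArc-irrefl = 1+n≢n

  pathArc-asym : ∀ {u v} → PathArc m u v → ¬ PathArc m v u
  pathArc-asym {u} u→v v→u = m≢1+n+m (toℕ u) {1} (trans (sym v→u) (cong suc (sym u→v)))

  pathArc-functional : ∀ {u v w} → PathArc m u v → PathArc m u w → v ≡ w
  pathArc-functional u→v u→w = toℕ-injective (trans (sym u→v) u→w)

x∉p-x : ∀ (p : Subset k) x → x ∉ p - x
x∉p-x (_ ∷ p) (Fin.suc x) (there x∈) = x∉p-x p x x∈

∈-swap⁻ : ∀ {u v x} → x ∈ (S - u) ∪ ⁅ v ⁆ → (x ∈ S × x ≢ u) ⊎ x ≡ v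
∈-swap⁻ {S = S} {u} {v} x∈ with x∈p∪q⁻ (S - u) ⁅ v ⁆ x∈
... | inj₁ x∈S-u = inj₁ (p─q⊆p S ⁅ u ⁆ x∈S-u , λ { refl → x∉p-x S u x∈S-u })
... | inj₂ x∈⁅v⁆ = inj₂ (x∈⁅y⁆⇒x≡y v x∈⁅v⁆)

∈-swap⁺ˡ : ∀ {u v x} → x ∈ S → x ≢ u → x ∈ (S - u) ∪ ⁅ v ⁆
∈-swap⁺ˡ x∈S x≢u = x∈p∪q⁺ (inj₁ (x∈p∧x≢y⇒x∈p-y x∈S x≢u))

∈-swap⁺ʳ : ∀ {u v} → v ∈ (S - u) ∪ ⁅ v ⁆
∈-swap⁺ʳ {v = v} = x∈p∪q⁺ (inj₂ (x∈⁅x⁆ v))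

defender∉swap : ∀ {u v} → PathArc m u v → u ∉ (S - u) ∪ ⁅ v ⁆
defender∉swap u→v u∈ with ∈-swap⁻ u∈
... | inj₁ (_ , u≢u) = u≢u refl
... | inj₂ refl      = pathArc-irrefl u→v

osods⇒doublyDominated : IsOSODS (P m) S → DoublyDominated S
osods⇒doublyDominated {m} {S = S} (_ , secure) i Sᵢ with ‼≡outside⇒∉ {i = i} Sᵢ
... | v , v≡i , v∉S with secure v v∉S
... | u , u∈S , u→v , swapDominating with swapDominating u (defender∉swap u→v)
... | w , w∈swap , w→u with ∈-swap⁻ w∈swap
...   | inj₂ refl      = ⊥-elim (pathArc-asym w→u u→v)
...   | inj₁ (w∈S , _) =
  toℕ w , trans (sym v≡i) (trans (sym u→v) (cong suc (sym w→u))) , ∈⇒‼≡inside w∈S ,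
  subst (λ n → S ‼ n ≡ inside) (sym w→u) (∈⇒‼≡inside u∈S)

predecessors : DoublyDominated S → ∀ {v} → v ∉ S →
  ∃₂ λ u w → u ∈ S × w ∈ S × PathArc m u v × PathArc m w u
predecessors {S = S} dd {v} v∉S with dd (toℕ v) (∉⇒‼≡outside v∉S)
... | j , v≡2+j , Sⱼ , S₁₊ⱼ with below v (≤-reflexive (sym v≡2+j))
... | u , u≡1+j with below u (≤-reflexive (sym u≡1+j))
... | w , w≡j =
  u , w , ‼≡inside⇒∈ u≡1+j S₁₊ⱼ , ‼≡inside⇒∈ w≡j Sⱼ ,
  trans (cong suc u≡1+j) (sym v≡2+j) , trans (cong suc w≡j) (sym u≡1+j)

doublyDominated⇒osods : DoublyDominated S → IsOSODS (P m) S
doublyDominated⇒osods {m} {S = S} dd = dominating , secure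
  where
  dominating : OutDominating (P m) S
  dominating v v∉S = let u , _ , u∈S , _ , u→v , _ = predecessors dd v∉S in u , u∈S , u→v

  secure : ∀ v → v ∉ S → ∃ λ u → u ∈ S × PathArc m u v × OutDominating (P m) ((S - u) ∪ ⁅ v ⁆)
  secure v v∉S with predecessors dd v∉S
  ... | u , w , u∈S , w∈S , u→v , w→u = u , u∈S , u→v , swapDominating
    where
    swapDominating : OutDominating (P m) ((S - u) ∪ ⁅ v ⁆)
    swapDominating x x∉ with x ≟ u
    ... | yes refl = w , ∈-swap⁺ˡ w∈S (λ { refl → pathArc-irrefl w→u }) , w→u
    ... | no x≢u with predecessors dd (x∉ ∘ λ x∈S → ∈-swap⁺ˡ x∈S x≢u)
    ...   | u′ , _ , u′∈S , _ , u′→x , _ = u′ , ∈-swap⁺ˡ u′∈S u′≢u , u′→x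
      where
      u′≢u : u′ ≢ u
      u′≢u refl = x∉ (subst (λ y → y ∈ (S - u) ∪ ⁅ v ⁆) (pathArc-functional u→v u′→x) ∈-swap⁺ʳ)

doublyDominated⇒k*2≤∣S∣*3 : (S : Subset k) → DoublyDominated S → k * 2 ≤ ∣ S ∣ * 3
doublyDominated⇒k*2≤∣S∣*3 [] _ = z≤n
doublyDominated⇒k*2≤∣S∣*3 (outside ∷ _) dd with dd 0 refl
... | _ , () , _
doublyDominated⇒k*2≤∣S∣*3 (inside ∷ []) _ = s≤s (s≤s z≤n)
doublyDominated⇒k*2≤∣S∣*3 (inside ∷ outside ∷ _) dd with dd 1 refl
... | _ , () , _
doublyDominated⇒k*2≤∣S∣*3 (inside ∷ inside ∷ []) _ = s≤s (s≤s (s≤s (s≤s z≤n)))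
doublyDominated⇒k*2≤∣S∣*3 (inside ∷ inside ∷ outside ∷ S) dd =
  +-monoʳ-≤ 6 (doublyDominated⇒k*2≤∣S∣*3 S drop110)
  where
  drop110 : DoublyDominated S
  drop110 i Sᵢ with dd (3 + i) Sᵢ
  drop110 zero          _ | .1 , refl , _ , ()
  drop110 (suc zero)    _ | .2 , refl , () , _
  drop110 (suc (suc i)) _ | .(3 + i) , refl , Sᵢ , S₁₊ᵢ = i , refl , Sᵢ , S₁₊ᵢ
doublyDominated⇒k*2≤∣S∣*3 (inside ∷ S@(inside ∷ inside ∷ _)) dd =
  s≤s (s≤s (≤-trans (doublyDominated⇒k*2≤∣S∣*3 S drop1) (n≤1+n _)))
  where
  drop1 : DoublyDominated S
  drop1 (suc (suc i)) Sᵢ with dd (3 + i) Sᵢ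
  ... | .(1 + i) , refl , Sᵢ , S₁₊ᵢ = i , refl , Sᵢ , S₁₊ᵢ

omitEveryThird : (k : ℕ) → Subset k
omitEveryThird 0                   = []
omitEveryThird 1                   = inside ∷ []
omitEveryThird 2                   = inside ∷ inside ∷ []
omitEveryThird (suc (suc (suc k))) = inside ∷ inside ∷ outside ∷ omitEveryThird k

omitEveryThird-doublyDominated : ∀ k → DoublyDominated (omitEveryThird k)
omitEveryThird-doublyDominated 1 0 ()
omitEveryThird-doublyDominated 2 0 ()
omitEveryThird-doublyDominated 2 1 ()
omitEveryThird-doublyDominated (suc (suc (suc k))) 0 ()
omitEveryThird-doublyDominated (suc (suc (suc k))) 1 ()
omitEveryThird-doublyDominated (suc (suc (suc k))) 2 _ = 0 , refl , refl , refl
omitEveryThird-doublyDominated (suc (suc (suc k))) (suc (suc (suc i))) Sᵢ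
  with omitEveryThird-doublyDominated k i Sᵢ
... | j , refl , Sⱼ , S₁₊ⱼ = 3 + j , refl , Sⱼ , S₁₊ⱼ

∣omitEveryThird∣ : ∀ k → ∣ omitEveryThird k ∣ ≡ (2 * k + 2) / 3
∣omitEveryThird∣ 0 = refl
∣omitEveryThird∣ 1 = refl
∣omitEveryThird∣ 2 = refl
∣omitEveryThird∣ (suc (suc (suc k))) = begin
  2 + ∣ omitEveryThird k ∣    ≡⟨ cong (2 +_) (∣omitEveryThird∣ k) ⟩
  2 + (2 * k + 2) / 3         ≡⟨ +-distrib-/-∣ˡ (2 * k + 2) {3} (divides-refl 2) ⟨
  (2 * 3 + (2 * k + 2)) / 3   ≡⟨ cong (_/ 3) (shift k) ⟩
  (2 * (3 + k) + 2) / 3       ∎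
  where
  open ≡-Reasoning
  shift : ∀ k → 2 * 3 + (2 * k + 2) ≡ 2 * (3 + k) + 2
  shift = solve-∀

k*2≤c*3⇒⌈2k/3⌉≤c : ∀ k c → k * 2 ≤ c * 3 → (2 * k + 2) / 3 ≤ c
k*2≤c*3⇒⌈2k/3⌉≤c k c k*2≤c*3 = s≤s⁻¹ (m<n*o⇒m/o<n (begin-strict
  2 * k + 2   ≡⟨ reorder k ⟩
  2 + k * 2   <⟨ s≤s (s≤s (s≤s k*2≤c*3)) ⟩
  3 + c * 3   ∎))
  where
  open ≤-Reasoning
  reorder : ∀ k → 2 * k + 2 ≡ 2 + k * 2
  reorder = solve-∀

proposition2p7 : (m : ℕ) → 1 ≤ m → IsMinOSODSSize (P m) ((2 * m + 2) / 3)
proposition2p7 m _ =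
  (omitEveryThird m , doublyDominated⇒osods (omitEveryThird-doublyDominated m) , ∣omitEveryThird∣ m) ,
  λ S osods → k*2≤c*3⇒⌈2k/3⌉≤c m ∣ S ∣ (doublyDominated⇒k*2≤∣S∣*3 S (osods⇒doublyDominated osods))
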